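{- Let $G=(X,Y,E)$ be a connected bipartite permutation graph and let $(<_X,<_Y)$ be a strong ordering on the vertices of $G$. Then for some positive integer $n$ there exist a sequence $X_1,\dots,X_n$ of nonempty intervals of $X$ (with respect to $<_X$) with $\bigcup_{i=1}^n X_i=X$ and a sequence $Y_1,\dots,Y_n$ of nonempty intervals of $Y$ (with respect to $<_Y$) with $\bigcup_{i=1}^n Y_i=Y$ such that: (1) for each $1\le p\le n$, $\bigcup_{i=1}^p X_i$ is an end segment of $X$ and $X_p$ is an initial segment of $\bigcup_{i=1}^p X_i$; (2) for each $1\le p\le n$, $\bigcup_{i=1}^p Y_i$ is an end segment of $Y$ and $Y_p$ is an initial segment of $\bigcup_{i=1}^p Y_i$; (3) $X_p\not\subseteq X_{p+1}$ and $Y_p\not\subseteq Y_{p+1}$ for each $1\le p\le n-1$; (4) for each $1\le p\le n-1$, at least one of $X_{p+1}\setminus X_p$ or $Y_{p+1}\setminus Y_p$ is nonempty; (5) for each $1\le p\le n$, $E(G_p)=E(G_{p-1})\cup (X_p\times Y_p)$, where $G_p$ denotes the subgraph of $G$ induced by $\bigcup_{i=1}^p X_i\cup\bigcup_{i=1}^p Y_i$ for $1\le p\le n$, and $E(G_0)=\emptyset$.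
   Context: Graphs are finite, simple and undirected; for a bipartite graph $G=(X,Y,E)$, edges are identified with pairs in $X\times Y$. A permutation graph is a graph $(V,E)$ admitting an ordering $v_1,\dots,v_n$ of $V$ and a permutation $\tau$ of $\{1,\dots,n\}$ with $(v_i,v_j)\in E\iff\tau(i)>\tau(j)$ for all $i<j$; a bipartite permutation graph is a bipartite graph that is a permutation graph. A strong ordering on the vertices of a bipartite graph $G=(X,Y,E)$ is a pair $(<_X,<_Y)$ of linear orders on $X$ and $Y$ such that for all $(x,y),(x',y')\in E$ with $x,x'\in X$, $y,y'\in Y$: if $x<_X x'$ and $y'<_Y y$ then $(x,y')\in E$ and $(x',y)\in E$. For a linear order on a set $A$, an interval is a set $I\subseteq A$ such that $u<v<u'$ with $u,u'\in I$ implies $v\in I$; an initial segment of a subset $B\subseteq A$ is a subset $C\subseteq B$ such that $c\in C$, $b\in B$, $b<c$ imply $b\in C$; an end segment is defined dually. -}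

module Defs where

open import Level using (0ℓ)
open import Data.Nat as ℕ using (ℕ; _∸_)
open import Data.Fin using (Fin; _<_)
open import Data.Sum using (_⊎_; inj₁; inj₂)
open import Data.Product using (Σ; ∃; _×_; _,_)
open import Data.Bool using (Bool; true)
open import Data.Empty using (⊥)
open import Relation.Nullary using (¬_)
open import Relation.Unary using (Pred; _∈_; _⊆_)
open import Relation.Binary using (Rel; IsStrictTotalOrder)
open import Relation.Binary.PropositionalEquality using (_≡_)
open import Relation.Binary.Construct.Closure.ReflexiveTransitive using (Star)
open import Function.Bundles using (_↔_; _⇔_; Inverse)
open import Data.Fin.Permutation using (Permutation′; _⟨$⟩ʳ_)

-- A finite bipartite graph G = (X, Y, E): X = Fin m, Y = Fin k (labels
-- only; the orders on X and Y are arbitrary, see below), and the edge set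
-- E ⊆ X × Y is given by its characteristic function.

BipEdges : ℕ → ℕ → Set
BipEdges m k = Fin m → Fin k → Bool

Edge : ∀ {m k} → BipEdges m k → Fin m → Fin k → Set
Edge E x y = E x y ≡ true

Vtx : ℕ → ℕ → Set
Vtx m k = Fin m ⊎ Fin k

Adj : ∀ {m k} → BipEdges m k → Vtx m k → Vtx m k → Set
Adj E (inj₁ x) (inj₁ x′) = ⊥
Adj E (inj₁ x) (inj₂ y)  = Edge E x y
Adj E (inj₂ y) (inj₁ x)  = Edge E x y
Adj E (inj₂ y) (inj₂ y′) = ⊥

Connected : ∀ {m k} → BipEdges m k → Set
Connected E = ∀ u v → Star (Adj E) u v

IsPermutationGraph : {V : Set} → Rel V 0ℓ → Set
IsPermutationGraph {V} A =
  Σ ℕ λ N → Σ (Fin N ↔ V) λ ord → Σ (Permutation′ N) λ τ →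
    ∀ i j → i < j →
      A (Inverse.to ord i) (Inverse.to ord j) ⇔ ((τ ⟨$⟩ʳ j) < (τ ⟨$⟩ʳ i))

IsBipPermutationGraph : ∀ {m k} → BipEdges m k → Set
IsBipPermutationGraph E = IsPermutationGraph (Adj E)

IsLinearOrder : {A : Set} → Rel A 0ℓ → Set
IsLinearOrder _<_ = IsStrictTotalOrder _≡_ _<_

IsStrongOrdering : ∀ {m k} → BipEdges m k →
                   Rel (Fin m) 0ℓ → Rel (Fin k) 0ℓ → Set
IsStrongOrdering E _<X_ _<Y_ =
  IsLinearOrder _<X_ × IsLinearOrder _<Y_ ×
  (∀ x x′ y y′ → Edge E x y → Edge E x′ y′ → x <X x′ → y′ <Y y →
     Edge E x y′ × Edge E x′ y)

IsInterval : {A : Set} → Rel A 0ℓ → Pred A 0ℓ → Set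
IsInterval {A} _<_ I = ∀ (u v u′ : A) → u ∈ I → u′ ∈ I → u < v → v < u′ → v ∈ I

IsInitialSegmentOf : {A : Set} → Rel A 0ℓ → Pred A 0ℓ → Pred A 0ℓ → Set
IsInitialSegmentOf {A} _<_ C B = C ⊆ B × (∀ (c b : A) → c ∈ C → b ∈ B → b < c → b ∈ C)

IsEndSegmentOf : {A : Set} → Rel A 0ℓ → Pred A 0ℓ → Pred A 0ℓ → Set
IsEndSegmentOf {A} _<_ C B = C ⊆ B × (∀ (c b : A) → c ∈ C → b ∈ B → c < b → b ∈ C)

Full : (A : Set) → Pred A 0ℓ
Full A a = Data.Unit.⊤
  where import Data.Unit

Nonempty : {A : Set} → Pred A 0ℓ → Set
Nonempty {A} P = Σ A λ a → a ∈ P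

-- Sequences S_1, S_2, … of subsets, indexed by ℕ (only 1..n is used)

UnionUpTo : {A : Set} → (ℕ → Pred A 0ℓ) → ℕ → Pred A 0ℓ
UnionUpTo S p a = Σ ℕ λ i → (1 ℕ.≤ i) × (i ℕ.≤ p) × a ∈ S i

-- E(G_p): edges of the subgraph induced by ⋃_{i≤p} X_i ∪ ⋃_{i≤p} Y_i
-- (for p = 0 this is the empty set, i.e. E(G_0) = ∅)
EdgesG : ∀ {m k} → BipEdges m k →
         (ℕ → Pred (Fin m) 0ℓ) → (ℕ → Pred (Fin k) 0ℓ) → ℕ →
         Fin m → Fin k → Set
EdgesG E Xs Ys p x y = Edge E x y × x ∈ UnionUpTo Xs p × y ∈ UnionUpTo Ys p

module Submission where

-- Only two consequences of the hypotheses are used: the strong ordering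
-- itself and, from connectivity, the absence of isolated vertices.  Under these, every
-- neighbourhood is an interval whose end points (lowY x , highY x), resp.
-- (lowX y , highX y), depend monotonically on the vertex, and two crossing
-- edges span a complete rectangle.
--
-- The blocks X_p × Y_p are peeled off starting at the top-right corner.  A
-- block is the complete rectangle [lowX d , c] × [lowY c , d] spanned by an
-- upper corner (c , d); the next upper corner is built from the
-- predecessors of the current lower corner (three cases: peelXY, peelX,
-- peelY) so that the lower corner drops, the parts stay contiguous and
-- every newly exposed edge lies in the new block.  Peeling stops when the
-- lower corner is at the bottom in both coordinates, and it terminates
-- because the sum of the ranks of the lower corner strictly decreases.

open import Level using (0ℓ)
open import Defs
open import Data.Nat as ℕ using (ℕ; zero; suc; _∸_)
import Data.Nat.Properties as ℕP
import Data.Nat.Induction as ℕI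
open import Induction.WellFounded using (Acc; acc)
import Data.Bool as Bool
open import Data.Bool using (true)
open import Data.Fin as Fin using (Fin)
open import Data.Fin.Subset as Subset using (Subset; inside; outside; ∣_∣)
open import Data.Fin.Subset.Properties using (p⊆q⇒∣p∣≤∣q∣; p⊂q⇒∣p∣<∣q∣)
open import Data.List using (List; filter; allFin)
open import Data.List.Membership.Propositional.Properties using (∈-allFin; ∈-filter⁺)
open import Data.List.Relation.Unary.All using (lookup)
open import Data.List.Relation.Unary.All.Properties using (all-filter)
import Data.List.Extrema as Extrema
open import Data.Vec using (tabulate)
open import Data.Vec.Properties using (lookup∘tabulate; lookup⇒[]=; []=⇒lookup)
open import Data.Product as Product using (Σ; _×_; _,_; proj₁; proj₂)
open import Data.Sum as Sum using (_⊎_; inj₁; inj₂)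
open import Data.Empty using (⊥; ⊥-elim)
open import Function using (id)
open import Function.Bundles using (_⇔_; mk⇔)
open import Relation.Nullary using (¬_; Dec; yes; no)
open import Relation.Nullary.Decidable using (_×-dec_)
open import Relation.Unary using (Pred; Decidable; _∈_; _⊆_)
open import Relation.Unary.Properties using (U?)
open import Relation.Binary using (Rel; IsStrictTotalOrder; StrictTotalOrder; tri<; tri≈; tri>)
open import Relation.Binary.PropositionalEquality using (_≡_; refl; sym; trans)
open import Relation.Binary.Construct.Closure.ReflexiveTransitive using (_◅_)
import Relation.Binary.Properties.StrictTotalOrder as StrictTotalOrderProperties

union-suc : {A : Set} (S : ℕ → Pred A 0ℓ) → ∀ {p a} → a ∈ UnionUpTo S p → a ∈ UnionUpTo S (suc p)
union-suc S (i , 1≤i , i≤p , a∈) = i , 1≤i , ℕP.m≤n⇒m≤1+n i≤p , a∈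

part⊆union : {A : Set} (S : ℕ → Pred A 0ℓ) → ∀ {p a} → a ∈ S (suc p) → a ∈ UnionUpTo S (suc p)
part⊆union S a∈ = _ , ℕ.s≤s ℕ.z≤n , ℕP.≤-refl , a∈

module FiniteStrictTotalOrder {n : ℕ} {_<_ : Rel (Fin n) 0ℓ}
                              (sto : IsStrictTotalOrder _≡_ _<_) where

  open IsStrictTotalOrder sto public using (compare; _<?_) renaming (trans to <-trans)

  infix 4 _≤_
  _≤_ : Rel (Fin n) 0ℓ
  x ≤ y = ¬ (y < x)

  <-irrefl : ∀ {x} → ¬ (x < x)
  <-irrefl = IsStrictTotalOrder.irrefl sto refl

  ≤-refl : ∀ {x} → x ≤ x
  ≤-refl = <-irrefl

  <⇒≤ : ∀ {x y} → x < y → x ≤ y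
  <⇒≤ x<y y<x = <-irrefl (<-trans x<y y<x)

  ≤⊎> : ∀ x y → x ≤ y ⊎ y < x
  ≤⊎> x y with y <? x
  ... | yes y<x = inj₂ y<x
  ... | no  y≮x = inj₁ y≮x

  ≤⇒<⊎≡ : ∀ {x y} → x ≤ y → x < y ⊎ x ≡ y
  ≤⇒<⊎≡ {x} {y} x≤y with compare x y
  ... | tri< x<y _ _ = inj₁ x<y
  ... | tri≈ _ x≡y _ = inj₂ x≡y
  ... | tri> _ _ y<x = ⊥-elim (x≤y y<x)

  <-≤-trans : ∀ {x y z} → x < y → y ≤ z → x < z
  <-≤-trans {x} {y} {z} x<y y≤z with ≤⇒<⊎≡ y≤z
  ... | inj₁ y<z  = <-trans x<y y<z
  ... | inj₂ refl = x<y

  ≤-<-trans : ∀ {x y z} → x ≤ y → y < z → x < z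
  ≤-<-trans {x} {y} {z} x≤y y<z with ≤⇒<⊎≡ x≤y
  ... | inj₁ x<y  = <-trans x<y y<z
  ... | inj₂ refl = y<z

  ≤-trans : ∀ {x y z} → x ≤ y → y ≤ z → x ≤ z
  ≤-trans x≤y y≤z z<x = y≤z (<-≤-trans z<x x≤y)

  private
    bundle : StrictTotalOrder 0ℓ 0ℓ 0ℓ
    bundle = record { isStrictTotalOrder = sto }
    open StrictTotalOrderProperties bundle using (totalOrder)
    open Extrema totalOrder using (min; max; argmin-all; argmax-all; min≤xs; xs≤max)

    fromReflexive : ∀ {x y} → x < y ⊎ x ≡ y → x ≤ y
    fromReflexive (inj₁ x<y)  = <⇒≤ x<y
    fromReflexive (inj₂ refl) = ≤-refl

  least : {P : Pred (Fin n) 0ℓ} → Decidable P → ∀ {b} → P b →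
          Σ (Fin n) λ x → P x × (∀ z → P z → x ≤ z)
  least P? {b} Pb =
    min b candidates ,
    argmin-all id Pb (all-filter P? (allFin n)) ,
    λ z Pz → fromReflexive (lookup (min≤xs b candidates) (∈-filter⁺ P? (∈-allFin z) Pz))
    where
    candidates : List (Fin n)
    candidates = filter P? (allFin n)

  greatest : {P : Pred (Fin n) 0ℓ} → Decidable P → ∀ {b} → P b →
             Σ (Fin n) λ x → P x × (∀ z → P z → z ≤ x)
  greatest P? {b} Pb =
    max b candidates ,
    argmax-all id Pb (all-filter P? (allFin n)) ,
    λ z Pz → fromReflexive (lookup (xs≤max b candidates) (∈-filter⁺ P? (∈-allFin z) Pz))
    where
    candidates : List (Fin n)
    candidates = filter P? (allFin n)

  -- The rank of u is the number of elements below it; it is strictly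
  -- monotone, which makes it a termination measure for descending processes.
  private
    side : {A : Set} → Dec A → Subset.Side
    side (yes _) = inside
    side (no  _) = outside

    side-yes : {A : Set} (a? : Dec A) → A → side a? ≡ inside
    side-yes (yes _) _ = refl
    side-yes (no ¬a) a = ⊥-elim (¬a a)

    side-inside : {A : Set} (a? : Dec A) → side a? ≡ inside → A
    side-inside (yes a) _  = a
    side-inside (no _)  ()

  below : Fin n → Subset n
  below u = tabulate λ x → side (x <? u)

  ∈-below⁺ : ∀ {x u} → x < u → x Subset.∈ below u
  ∈-below⁺ {x} {u} x<u =
    lookup⇒[]= x (below u) (trans (lookup∘tabulate _ x) (side-yes (x <? u) x<u))

  ∈-below⁻ : ∀ {x u} → x Subset.∈ below u → x < u
  ∈-below⁻ {x} {u} x∈ =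
    side-inside (x <? u) (trans (sym (lookup∘tabulate _ x)) ([]=⇒lookup x∈))

  rank : Fin n → ℕ
  rank u = ∣ below u ∣

  rank-mono : ∀ {x y} → x ≤ y → rank x ℕ.≤ rank y
  rank-mono x≤y = p⊆q⇒∣p∣≤∣q∣ λ z∈ → ∈-below⁺ (<-≤-trans (∈-below⁻ z∈) x≤y)

  rank-strict : ∀ {x y} → x < y → rank x ℕ.< rank y
  rank-strict {x} x<y = p⊂q⇒∣p∣<∣q∣
    ( (λ z∈ → ∈-below⁺ (<-trans (∈-below⁻ z∈) x<y))
    , x , ∈-below⁺ x<y , λ x∈ → <-irrefl (∈-below⁻ x∈) )

  -- A chain of intervals [lo q , hi q], q = 0 … N, that starts at the top
  -- and descends without gaps.  Its p-th part (p = 1 … N + 1) is the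
  -- interval with index p ∸ 1, and the union of the first p parts is the
  -- end segment above lo (p ∸ 1).
  module DescendingIntervals
    (lo hi : ℕ → Fin n) (N : ℕ)
    (lo≤hi : ∀ q → lo q ≤ hi q)
    (hi-top : ∀ x → x ≤ hi 0)
    (lo-step : ∀ q → q ℕ.< N → lo (suc q) ≤ lo q)
    (no-gap : ∀ q → q ℕ.< N → ∀ x → x < lo q → x ≤ hi (suc q)) where

    Part : ℕ → Pred (Fin n) 0ℓ
    Part p x = lo (p ∸ 1) ≤ x × x ≤ hi (p ∸ 1)

    lo-antitone : ∀ {j q} → j ℕ.≤ q → q ℕ.≤ N → lo q ≤ lo j
    lo-antitone {q = zero}  ℕ.z≤n _ = ≤-refl
    lo-antitone {j} {suc q} j≤q q<N with ℕP.m≤n⇒m<n∨m≡n j≤q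
    ... | inj₂ refl           = ≤-refl
    ... | inj₁ (ℕ.s≤s j≤q′) = ≤-trans (lo-step q q<N) (lo-antitone j≤q′ (ℕP.<⇒≤ q<N))

    union⁻ : ∀ {q x} → q ℕ.≤ N → x ∈ UnionUpTo Part (suc q) → lo q ≤ x
    union⁻ q≤N (suc j , _ , ℕ.s≤s j≤q , lo≤x , _) = ≤-trans (lo-antitone j≤q q≤N) lo≤x

    union⁺ : ∀ {q x} → q ℕ.≤ N → lo q ≤ x → x ∈ UnionUpTo Part (suc q)
    union⁺ {zero} _ lo≤x = 1 , ℕP.≤-refl , ℕP.≤-refl , lo≤x , hi-top _
    union⁺ {suc q} {x} q<N lo≤x with ≤⊎> (lo q) x
    ... | inj₁ lo≤x′ = union-suc Part (union⁺ (ℕP.<⇒≤ q<N) lo≤x′)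
    ... | inj₂ x<lo  = part⊆union Part (lo≤x , no-gap q q<N x x<lo)

    part-nonempty-interval : ∀ p → Nonempty (Part p) × IsInterval _<_ (Part p)
    part-nonempty-interval p =
      (lo q , ≤-refl , lo≤hi q) ,
      λ a b a′ (lo≤a , _) (_ , a′≤hi) a<b b<a′ → ≤-trans lo≤a (<⇒≤ a<b) , ≤-trans (<⇒≤ b<a′) a′≤hi
      where
      q : ℕ
      q = p ∸ 1

    covers : (∀ x → lo N ≤ x) → ∀ x → x ∈ UnionUpTo Part (suc N)
    covers lo-bottom x = union⁺ ℕP.≤-refl (lo-bottom x)

    segments : ∀ p → 1 ℕ.≤ p → p ℕ.≤ suc N →
               IsEndSegmentOf _<_ (UnionUpTo Part p) (Full (Fin n)) ×
               IsInitialSegmentOf _<_ (Part p) (UnionUpTo Part p)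
    segments (suc q) _ (ℕ.s≤s q≤N) =
      ( (λ _ → _)
      , λ a b a∈ _ a<b → union⁺ q≤N (≤-trans (union⁻ q≤N a∈) (<⇒≤ a<b)) ) ,
      ( part⊆union Part
      , λ a b (_ , a≤hi) b∈ b<a → union⁻ q≤N b∈ , ≤-trans (<⇒≤ b<a) a≤hi )

    not-nested : ∀ {q} → hi (suc q) < hi q → ¬ (Part (suc q) ⊆ Part (suc (suc q)))
    not-nested {q} hi′<hi sub = proj₂ (sub {hi q} (lo≤hi q , ≤-refl)) hi′<hi

    new-element : ∀ {q} → lo (suc q) < lo q →
                  Σ (Fin n) λ x → x ∈ Part (suc (suc q)) × ¬ (x ∈ Part (suc q))
    new-element {q} lo′<lo = lo (suc q) , (≤-refl , lo≤hi (suc q)) , λ (lo≤ , _) → lo≤ lo′<lo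

  -- Given any element (so that Fin n is inhabited): the bottom and top
  -- elements, and the predecessor of every element above the bottom.
  module Bounds (x₀ : Fin n) where

    bottom : Fin n
    bottom = proj₁ (least U? {x₀} _)

    bottom-≤ : ∀ z → bottom ≤ z
    bottom-≤ z = proj₂ (proj₂ (least U? {x₀} _)) z _

    top : Fin n
    top = proj₁ (greatest U? {x₀} _)

    ≤-top : ∀ z → z ≤ top
    ≤-top z = proj₂ (proj₂ (greatest U? {x₀} _)) z _

    -- The predecessor of u (defined as u itself when u is the bottom).
    predecessor : Fin n → Fin n
    predecessor u with bottom <? u
    ... | yes b<u = proj₁ (greatest (_<? u) b<u)
    ... | no  _   = u

    predecessor-< : ∀ {u} → bottom < u → predecessor u < u
    predecessor-< {u} b<u with bottom <? u
    ... | yes b<u′ = proj₁ (proj₂ (greatest (_<? u) b<u′))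
    ... | no  b≮u  = ⊥-elim (b≮u b<u)

    predecessor-greatest : ∀ {u} → bottom < u → ∀ z → z < u → z ≤ predecessor u
    predecessor-greatest {u} b<u with bottom <? u
    ... | yes b<u′ = proj₂ (proj₂ (greatest (_<? u) b<u′))
    ... | no  b≮u  = ⊥-elim (b≮u b<u)

module StronglyOrderedGraph
  {m k : ℕ} (E : BipEdges m k) {_<X_ : Rel (Fin m) 0ℓ} {_<Y_ : Rel (Fin k) 0ℓ}
  (strong : IsStrongOrdering E _<X_ _<Y_)
  (neighbourY : ∀ x → Σ (Fin k) (Edge E x))
  (neighbourX : ∀ y → Σ (Fin m) λ x → Edge E x y) where

  stoX : IsStrictTotalOrder _≡_ _<X_
  stoX = proj₁ strong
  stoY : IsStrictTotalOrder _≡_ _<Y_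
  stoY = proj₁ (proj₂ strong)

  exchange : ∀ x x′ y y′ → Edge E x y → Edge E x′ y′ → x <X x′ → y′ <Y y →
             Edge E x y′ × Edge E x′ y
  exchange = proj₂ (proj₂ strong)

  module OX = FiniteStrictTotalOrder stoX
  module OY = FiniteStrictTotalOrder stoY
  open OX using () renaming (_≤_ to _≤X_)
  open OY using () renaming (_≤_ to _≤Y_)

  Edge? : ∀ x y → Dec (Edge E x y)
  Edge? x y = E x y Bool.≟ true

  private
    lowestY : ∀ x → Σ (Fin k) λ y → Edge E x y × (∀ z → Edge E x z → y ≤Y z)
    highestY : ∀ x → Σ (Fin k) λ y → Edge E x y × (∀ z → Edge E x z → z ≤Y y)
    lowestY  x = OY.least    (Edge? x) (proj₂ (neighbourY x))
    highestY x = OY.greatest (Edge? x) (proj₂ (neighbourY x))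
    lowestX : ∀ y → Σ (Fin m) λ x → Edge E x y × (∀ z → Edge E z y → x ≤X z)
    highestX : ∀ y → Σ (Fin m) λ x → Edge E x y × (∀ z → Edge E z y → z ≤X x)
    lowestX  y = OX.least    (λ x → Edge? x y) (proj₂ (neighbourX y))
    highestX y = OX.greatest (λ x → Edge? x y) (proj₂ (neighbourX y))

  lowY highY : Fin m → Fin k
  lowY  x = proj₁ (lowestY x)
  highY x = proj₁ (highestY x)
  lowX highX : Fin k → Fin m
  lowX  y = proj₁ (lowestX y)
  highX y = proj₁ (highestX y)

  lowY-edge : ∀ x → Edge E x (lowY x)
  lowY-edge x = proj₁ (proj₂ (lowestY x))
  lowY-≤ : ∀ x y → Edge E x y → lowY x ≤Y y
  lowY-≤ x = proj₂ (proj₂ (lowestY x))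
  highY-edge : ∀ x → Edge E x (highY x)
  highY-edge x = proj₁ (proj₂ (highestY x))
  ≤-highY : ∀ x y → Edge E x y → y ≤Y highY x
  ≤-highY x = proj₂ (proj₂ (highestY x))
  lowX-edge : ∀ y → Edge E (lowX y) y
  lowX-edge y = proj₁ (proj₂ (lowestX y))
  lowX-≤ : ∀ y x → Edge E x y → lowX y ≤X x
  lowX-≤ y = proj₂ (proj₂ (lowestX y))
  highX-edge : ∀ y → Edge E (highX y) y
  highX-edge y = proj₁ (proj₂ (highestX y))
  ≤-highX : ∀ y x → Edge E x y → x ≤X highX y
  ≤-highX y = proj₂ (proj₂ (highestX y))

  row-convex : ∀ {x y₁ y₂ y} → Edge E x y₁ → Edge E x y₂ → y₁ ≤Y y → y ≤Y y₂ → Edge E x y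
  row-convex {x} {y₁} {y₂} {y} e₁ e₂ y₁≤y y≤y₂ with OY.≤⇒<⊎≡ y₁≤y | OY.≤⇒<⊎≡ y≤y₂
  ... | inj₂ refl | _         = e₁
  ... | inj₁ _    | inj₂ refl = e₂
  ... | inj₁ y₁<y | inj₁ y<y₂ with neighbourX y
  ...   | x′ , e′ with OX.compare x x′
  ...     | tri< x<x′ _ _ = proj₁ (exchange x x′ y₂ y e₂ e′ x<x′ y<y₂)
  ...     | tri≈ _ refl _ = e′
  ...     | tri> _ _ x′<x = proj₂ (exchange x′ x y y₁ e′ e₁ x′<x y₁<y)

  column-convex : ∀ {y x₁ x₂ x} → Edge E x₁ y → Edge E x₂ y → x₁ ≤X x → x ≤X x₂ → Edge E x y
  column-convex {y} {x₁} {x₂} {x} e₁ e₂ x₁≤x x≤x₂ with OX.≤⇒<⊎≡ x₁≤x | OX.≤⇒<⊎≡ x≤x₂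
  ... | inj₂ refl | _         = e₁
  ... | inj₁ _    | inj₂ refl = e₂
  ... | inj₁ x₁<x | inj₁ x<x₂ with neighbourY x
  ...   | y′ , e′ with OY.compare y y′
  ...     | tri< y<y′ _ _ = proj₁ (exchange x x₂ y′ y e′ e₂ x<x₂ y<y′)
  ...     | tri≈ _ refl _ = e′
  ...     | tri> _ _ y′<y = proj₂ (exchange x₁ x y y′ e₁ e′ x₁<x y′<y)

  lowY-mono : ∀ {x x′} → x ≤X x′ → lowY x ≤Y lowY x′
  lowY-mono {x} {x′} x≤x′ l′<l with OX.≤⇒<⊎≡ x≤x′
  ... | inj₂ refl = OY.<-irrefl l′<l
  ... | inj₁ x<x′ = lowY-≤ x (lowY x′)
      (proj₁ (exchange x x′ (lowY x) (lowY x′) (lowY-edge x) (lowY-edge x′) x<x′ l′<l)) l′<l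

  highY-mono : ∀ {x x′} → x ≤X x′ → highY x ≤Y highY x′
  highY-mono {x} {x′} x≤x′ h′<h with OX.≤⇒<⊎≡ x≤x′
  ... | inj₂ refl = OY.<-irrefl h′<h
  ... | inj₁ x<x′ = ≤-highY x′ (highY x)
      (proj₂ (exchange x x′ (highY x) (highY x′) (highY-edge x) (highY-edge x′) x<x′ h′<h)) h′<h

  lowX-mono : ∀ {y y′} → y ≤Y y′ → lowX y ≤X lowX y′
  lowX-mono {y} {y′} y≤y′ l′<l with OY.≤⇒<⊎≡ y≤y′
  ... | inj₂ refl = OX.<-irrefl l′<l
  ... | inj₁ y<y′ = lowX-≤ y (lowX y′)
      (proj₁ (exchange (lowX y′) (lowX y) y′ y (lowX-edge y′) (lowX-edge y) l′<l y<y′)) l′<l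

  highX-mono : ∀ {y y′} → y ≤Y y′ → highX y ≤X highX y′
  highX-mono {y} {y′} y≤y′ h′<h with OY.≤⇒<⊎≡ y≤y′
  ... | inj₂ refl = OX.<-irrefl h′<h
  ... | inj₁ y<y′ = ≤-highX y′ (highX y)
      (proj₂ (exchange (highX y′) (highX y) y′ y (highX-edge y′) (highX-edge y) h′<h y<y′)) h′<h

  exchange-≤ : ∀ {x x′ y y′} → Edge E x y → Edge E x′ y′ → x ≤X x′ → y′ ≤Y y →
               Edge E x y′ × Edge E x′ y
  exchange-≤ {x} {x′} {y} {y′} e e′ x≤x′ y′≤y with OX.≤⇒<⊎≡ x≤x′ | OY.≤⇒<⊎≡ y′≤y
  ... | inj₂ refl | _         = e′ , e
  ... | inj₁ _    | inj₂ refl = e , e′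
  ... | inj₁ x<x′ | inj₁ y′<y = exchange x x′ y y′ e e′ x<x′ y′<y

  rectangle : ∀ {u c v d} → Edge E u d → Edge E c v → u ≤X c → v ≤Y d →
              ∀ x y → u ≤X x → x ≤X c → v ≤Y y → y ≤Y d → Edge E x y
  rectangle {u} {c} {v} {d} eud ecv u≤c v≤d x y u≤x x≤c v≤y y≤d =
    row-convex (column-convex euv ecv u≤x x≤c) (column-convex eud ecd u≤x x≤c) v≤y y≤d
    where
    corners : Edge E u v × Edge E c d
    corners = exchange-≤ eud ecv u≤c v≤d
    euv : Edge E u v
    euv = proj₁ corners
    ecd : Edge E c d
    ecd = proj₂ corners

  module Peeling (x₀ : Fin m) (y₀ : Fin k) where

    module BX = OX.Bounds x₀
    module BY = OY.Bounds y₀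
    open BX using () renaming (bottom to bottomX; predecessor to predX)
    open BY using () renaming (bottom to bottomY; predecessor to predY)

    -- A block is given by its upper corner (c , d) and is the rectangle
    -- [u , c] × [v , d] with u = lowX d and v = lowY c; the invariants
    -- say that it is nonempty.
    record Block : Set where
      constructor block
      field
        c : Fin m
        d : Fin k
        u≤c : lowX d ≤X c
        v≤d : lowY c ≤Y d
    open Block public

    u : Block → Fin m
    u s = lowX (d s)
    v : Block → Fin k
    v s = lowY (c s)

    complete : (s : Block) → ∀ x y → u s ≤X x → x ≤X c s → v s ≤Y y → y ≤Y d s → Edge E x y
    complete s = rectangle (lowX-edge (d s)) (lowY-edge (c s)) (u≤c s) (v≤d s)

    corner : (s : Block) → Edge E (u s) (v s)
    corner s = complete s (u s) (v s) OX.≤-refl (u≤c s) OY.≤-refl (v≤d s)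

    initial : Block
    initial = block BX.top BY.top (BX.≤-top _) (BY.≤-top _)

    Finished : Block → Set
    Finished s = ¬ (bottomX <X u s) × ¬ (bottomY <Y v s)

    record Peel (s s′ : Block) : Set where
      field
        c-< : c s′ <X c s
        d-< : d s′ <Y d s
        u-≤ : u s′ ≤X u s
        v-≤ : v s′ ≤Y v s
        strict : u s′ <X u s ⊎ v s′ <Y v s
        contiguousX : ∀ x → x <X u s → x ≤X c s′
        contiguousY : ∀ y → y <Y v s → y ≤Y d s′
        cover : ∀ x y → Edge E x y → u s′ ≤X x → v s′ ≤Y y → x <X u s ⊎ y <Y v s →
                x ≤X c s′ × y ≤Y d s′

    -- A vertex x below u adjacent to some y ≤ d sees only vertices strictly
    -- below d: otherwise (x , d) would be an edge although x < u = lowX d.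
    highY-<-d : (s : Block) → ∀ {x y} → x <X u s → Edge E x y → y ≤Y d s → highY x <Y d s
    highY-<-d s {x} x<u exy y≤d with OY.≤⊎> (d s) (highY x)
    ... | inj₂ h<d = h<d
    ... | inj₁ d≤h = ⊥-elim (lowX-≤ (d s) x (row-convex exy (highY-edge x) y≤d d≤h) x<u)

    highX-<-c : (s : Block) → ∀ {x y} → y <Y v s → Edge E x y → x ≤X c s → highX y <X c s
    highX-<-c s {y = y} y<v exy x≤c with OX.≤⊎> (c s) (highX y)
    ... | inj₂ h<c = h<c
    ... | inj₁ c≤h = ⊥-elim (lowY-≤ (c s) y (column-convex exy (highX-edge y) x≤c c≤h) y<v)

    above-or-exposed : (s : Block) → ∀ x y → (u s ≤X x × v s ≤Y y) ⊎ (x <X u s ⊎ y <Y v s)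
    above-or-exposed s x y with OX.≤⊎> (u s) x | OY.≤⊎> (v s) y
    ... | inj₁ u≤x | inj₁ v≤y = inj₁ (u≤x , v≤y)
    ... | inj₂ x<u | _        = inj₂ (inj₁ x<u)
    ... | inj₁ _   | inj₂ y<v = inj₂ (inj₂ y<v)

    peel-edge : ∀ {s s′} → Peel s s′ → ∀ {x y} → Edge E x y → u s′ ≤X x → v s′ ≤Y y →
                (u s ≤X x × v s ≤Y y) ⊎ ((u s′ ≤X x × x ≤X c s′) × (v s′ ≤Y y × y ≤Y d s′))
    peel-edge {s} P {x} {y} e u′≤x v′≤y =
      Sum.map₂ (λ new → Product.map (u′≤x ,_) (v′≤y ,_) (Peel.cover P x y e u′≤x v′≤y new))
               (above-or-exposed s x y)

    CaseXY CaseX CaseY : Block → Set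
    CaseXY s = bottomX <X u s × bottomY <Y v s × Edge E (predX (u s)) (predY (v s))
    CaseX  s = bottomX <X u s × Edge E (predX (u s)) (v s)
    CaseY  s = bottomY <Y v s × Edge E (u s) (predY (v s))

    peelXY : (s : Block) → CaseXY s → Σ Block (Peel s)
    peelXY s (bX<u , bY<v , e) = s′ , record
      { c-< = highX-<-c s pv<v e (OX.<⇒≤ (OX.<-≤-trans pu<u (u≤c s)))
      ; d-< = highY-<-d s pu<u e (OY.<⇒≤ (OY.<-≤-trans pv<v (v≤d s)))
      ; u-≤ = OX.<⇒≤ u′<u
      ; v-≤ = OY.<⇒≤ (OY.≤-<-trans v′≤pv pv<v)
      ; strict = inj₁ u′<u
      ; contiguousX = belowX
      ; contiguousY = belowY
      ; cover = λ where
          x y exy _ _ (inj₁ x<u) →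
            belowX x x<u , OY.≤-trans (≤-highY x y exy) (highY-mono (BX.predecessor-greatest bX<u x x<u))
          x y exy _ _ (inj₂ y<v) →
            OX.≤-trans (≤-highX y x exy) (highX-mono (BY.predecessor-greatest bY<v y y<v)) , belowY y y<v
      }
      where
      pu : Fin m
      pu = predX (u s)
      pv : Fin k
      pv = predY (v s)
      pu<u : pu <X u s
      pu<u = BX.predecessor-< bX<u
      pv<v : pv <Y v s
      pv<v = BY.predecessor-< bY<v
      u′≤pu : lowX (highY pu) ≤X pu
      u′≤pu = lowX-≤ (highY pu) pu (highY-edge pu)
      v′≤pv : lowY (highX pv) ≤Y pv
      v′≤pv = lowY-≤ (highX pv) pv (highX-edge pv)
      s′ : Block
      s′ = block (highX pv) (highY pu)
             (OX.≤-trans u′≤pu (≤-highX pv pu e)) (OY.≤-trans v′≤pv (≤-highY pu pv e))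
      u′<u : u s′ <X u s
      u′<u = OX.≤-<-trans u′≤pu pu<u
      belowX : ∀ x → x <X u s → x ≤X highX pv
      belowX x x<u = OX.≤-trans (BX.predecessor-greatest bX<u x x<u) (≤-highX pv pu e)
      belowY : ∀ y → y <Y v s → y ≤Y highY pu
      belowY y y<v = OY.≤-trans (BY.predecessor-greatest bY<v y y<v) (≤-highY pu pv e)

    peelX : (s : Block) → ¬ CaseXY s → CaseX s → Σ Block (Peel s)
    peelX s ¬xy (bX<u , e) = s′ , record
      { c-< = OX.<-≤-trans pu<u (u≤c s)
      ; d-< = highY-<-d s pu<u e (v≤d s)
      ; u-≤ = OX.<⇒≤ u′<u
      ; v-≤ = lowY-≤ pu (v s) e
      ; strict = inj₁ u′<u
      ; contiguousX = BX.predecessor-greatest bX<u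
      ; contiguousY = λ y y<v → OY.<⇒≤ (OY.<-≤-trans y<v (≤-highY pu (v s) e))
      ; cover = λ where
          x y exy _ _ (inj₁ x<u) →
            BX.predecessor-greatest bX<u x x<u ,
            OY.≤-trans (≤-highY x y exy) (highY-mono (BX.predecessor-greatest bX<u x x<u))
          x y exy _ v′≤y (inj₂ y<v) → ⊥-elim (OY.<-irrefl (OY.<-≤-trans y<v (OY.≤-trans v≤v′ v′≤y)))
      }
      where
      pu : Fin m
      pu = predX (u s)
      pu<u : pu <X u s
      pu<u = BX.predecessor-< bX<u
      u′≤pu : lowX (highY pu) ≤X pu
      u′≤pu = lowX-≤ (highY pu) pu (highY-edge pu)
      s′ : Block
      s′ = block pu (highY pu) u′≤pu (OY.≤-trans (lowY-≤ pu (v s) e) (≤-highY pu (v s) e))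
      u′<u : u s′ <X u s
      u′<u = OX.≤-<-trans u′≤pu pu<u
      -- if pu saw a vertex below v it would see predY v, by convexity
      v≤v′ : v s ≤Y lowY pu
      v≤v′ l<v = ¬xy (bX<u , bY<v , row-convex (lowY-edge pu) e
                        (BY.predecessor-greatest bY<v (lowY pu) l<v) (OY.<⇒≤ (BY.predecessor-< bY<v)))
        where
        bY<v : bottomY <Y v s
        bY<v = OY.≤-<-trans (BY.bottom-≤ (lowY pu)) l<v

    peelY : (s : Block) → ¬ CaseXY s → CaseY s → Σ Block (Peel s)
    peelY s ¬xy (bY<v , e) = s′ , record
      { c-< = highX-<-c s pv<v e (u≤c s)
      ; d-< = OY.<-≤-trans pv<v (v≤d s)
      ; u-≤ = lowX-≤ pv (u s) e
      ; v-≤ = OY.<⇒≤ v′<v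
      ; strict = inj₂ v′<v
      ; contiguousX = λ x x<u → OX.<⇒≤ (OX.<-≤-trans x<u (≤-highX pv (u s) e))
      ; contiguousY = BY.predecessor-greatest bY<v
      ; cover = λ where
          x y exy u′≤x _ (inj₁ x<u) → ⊥-elim (OX.<-irrefl (OX.<-≤-trans x<u (OX.≤-trans u≤u′ u′≤x)))
          x y exy _ _ (inj₂ y<v) →
            OX.≤-trans (≤-highX y x exy) (highX-mono (BY.predecessor-greatest bY<v y y<v)) ,
            BY.predecessor-greatest bY<v y y<v
      }
      where
      pv : Fin k
      pv = predY (v s)
      pv<v : pv <Y v s
      pv<v = BY.predecessor-< bY<v
      v′≤pv : lowY (highX pv) ≤Y pv
      v′≤pv = lowY-≤ (highX pv) pv (highX-edge pv)
      s′ : Block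
      s′ = block (highX pv) pv (OX.≤-trans (lowX-≤ pv (u s) e) (≤-highX pv (u s) e)) v′≤pv
      v′<v : v s′ <Y v s
      v′<v = OY.≤-<-trans v′≤pv pv<v
      -- if pv saw a vertex below u it would see predX u, by convexity
      u≤u′ : u s ≤X lowX pv
      u≤u′ l<u = ¬xy (bX<u , bY<v , column-convex (lowX-edge pv) e
                        (BX.predecessor-greatest bX<u (lowX pv) l<u) (OX.<⇒≤ (BX.predecessor-< bX<u)))
        where
        bX<u : bottomX <X u s
        bX<u = OX.≤-<-trans (BX.bottom-≤ (lowX pv)) l<u

    no-peel⇒finished : (s : Block) → ¬ CaseXY s → ¬ CaseX s → ¬ CaseY s → Finished s
    no-peel⇒finished s ¬xy ¬x ¬y =
      (λ bX<u → both bX<u (OY.≤-<-trans (BY.bottom-≤ _) (highY-pu<v bX<u))) ,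
      (λ bY<v → both (OX.≤-<-trans (BX.bottom-≤ _) (highX-pv<u bY<v)) bY<v)
      where
      pu : Fin m
      pu = predX (u s)
      pv : Fin k
      pv = predY (v s)
      -- without CaseX, all neighbours of pu lie strictly below v
      highY-pu<v : bottomX <X u s → highY pu <Y v s
      highY-pu<v bX<u with OY.≤⊎> (v s) (highY pu)
      ... | inj₂ h<v = h<v
      ... | inj₁ v≤h = ⊥-elim (¬x (bX<u , row-convex (lowY-edge pu) (highY-edge pu) lowY-pu≤v v≤h))
        where
        lowY-pu≤v : lowY pu ≤Y v s
        lowY-pu≤v = OY.≤-trans (lowY-mono (OX.<⇒≤ (BX.predecessor-< bX<u))) (lowY-≤ (u s) (v s) (corner s))
      -- without CaseY, all neighbours of pv lie strictly below u
      highX-pv<u : bottomY <Y v s → highX pv <X u s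
      highX-pv<u bY<v with OX.≤⊎> (u s) (highX pv)
      ... | inj₂ h<u = h<u
      ... | inj₁ u≤h = ⊥-elim (¬y (bY<v , column-convex (lowX-edge pv) (highX-edge pv) lowX-pv≤u u≤h))
        where
        lowX-pv≤u : lowX pv ≤X u s
        lowX-pv≤u = OX.≤-trans (lowX-mono (OY.<⇒≤ (BY.predecessor-< bY<v))) (lowX-≤ (v s) (u s) (corner s))
      -- then the edges (highX pv , pv) and (pu , highY pu) cross, forcing (pu , pv)
      both : bottomX <X u s → bottomY <Y v s → ⊥
      both bX<u bY<v = ¬xy (bX<u , bY<v , proj₂ (exchange-≤ (highX-edge pv) (highY-edge pu)
        (BX.predecessor-greatest bX<u _ (highX-pv<u bY<v))
        (BY.predecessor-greatest bY<v _ (highY-pu<v bX<u))))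

    CaseXY? : ∀ s → Dec (CaseXY s)
    CaseXY? s = (bottomX OX.<? u s) ×-dec (bottomY OY.<? v s) ×-dec Edge? _ _
    CaseX? : ∀ s → Dec (CaseX s)
    CaseX? s = (bottomX OX.<? u s) ×-dec Edge? _ _
    CaseY? : ∀ s → Dec (CaseY s)
    CaseY? s = (bottomY OY.<? v s) ×-dec Edge? _ _

    peel-or-finish : (s : Block) → Finished s ⊎ Σ Block (Peel s)
    peel-or-finish s with CaseXY? s
    ... | yes xy = inj₂ (peelXY s xy)
    ... | no ¬xy with CaseX? s
    ...   | yes x = inj₂ (peelX s ¬xy x)
    ...   | no ¬x with CaseY? s
    ...     | yes y = inj₂ (peelY s ¬xy y)
    ...     | no ¬y = inj₁ (no-peel⇒finished s ¬xy ¬x ¬y)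

    measure : Block → ℕ
    measure s = OX.rank (u s) ℕ.+ OY.rank (v s)

    peel-decreases : ∀ {s s′} → Peel s s′ → measure s′ ℕ.< measure s
    peel-decreases p with Peel.strict p
    ... | inj₁ u′<u = ℕP.+-mono-<-≤ (OX.rank-strict u′<u) (OY.rank-mono (Peel.v-≤ p))
    ... | inj₂ v′<v = ℕP.+-mono-≤-< (OX.rank-mono (Peel.u-≤ p)) (OY.rank-strict v′<v)

    _◂_ : Block → (ℕ → Block) → ℕ → Block
    (s ◂ S) zero    = s
    (s ◂ S) (suc q) = S q

    record Descent (s : Block) : Set where
      field
        steps    : ℕ
        later    : ℕ → Block
        finished : Finished ((s ◂ later) steps)
        peels    : ∀ q → q ℕ.< steps → Peel ((s ◂ later) q) ((s ◂ later) (suc q))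

    descent : (s : Block) → Descent s
    descent s = go s (ℕI.<-wellFounded (measure s))
      where
      go : (s : Block) → Acc ℕ._<_ (measure s) → Descent s
      go s (acc rec) with peel-or-finish s
      ... | inj₁ fin = record { steps = 0 ; later = λ _ → s ; finished = fin ; peels = λ _ () }
      ... | inj₂ (s′ , p) = record
        { steps    = suc (Descent.steps rest)
        ; later    = s′ ◂ Descent.later rest
        ; finished = Descent.finished rest
        ; peels    = λ where
            zero    _           → p
            (suc q) (ℕ.s≤s q<N) → Descent.peels rest q q<N
        }
        where
        rest : Descent s′
        rest = go s′ (rec (peel-decreases p))

    module Decomposition (D : Descent initial) where
      open Descent D using (steps; later; finished; peels)

      blocks : ℕ → Block
      blocks = initial ◂ later

      module IX = OX.DescendingIntervals (λ q → u (blocks q)) (λ q → c (blocks q)) steps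
        (λ q → u≤c (blocks q)) BX.≤-top
        (λ q q<N → Peel.u-≤ (peels q q<N)) (λ q q<N → Peel.contiguousX (peels q q<N))
      module IY = OY.DescendingIntervals (λ q → v (blocks q)) (λ q → d (blocks q)) steps
        (λ q → v≤d (blocks q)) BY.≤-top
        (λ q q<N → Peel.v-≤ (peels q q<N)) (λ q q<N → Peel.contiguousY (peels q q<N))

      Xs : ℕ → Pred (Fin m) 0ℓ
      Xs = IX.Part
      Ys : ℕ → Pred (Fin k) 0ℓ
      Ys = IY.Part

      coversX : ∀ x → x ∈ UnionUpTo Xs (suc steps)
      coversX = IX.covers λ x → OX.≤-trans (proj₁ finished) (BX.bottom-≤ x)

      coversY : ∀ y → y ∈ UnionUpTo Ys (suc steps)
      coversY = IY.covers λ y → OY.≤-trans (proj₂ finished) (BY.bottom-≤ y)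

      not-nested : ∀ p → 1 ℕ.≤ p → suc p ℕ.≤ suc steps →
                   ¬ (Xs p ⊆ Xs (suc p)) × ¬ (Ys p ⊆ Ys (suc p))
      not-nested (suc q) _ (ℕ.s≤s q<N) =
        IX.not-nested {q} (Peel.c-< (peels q q<N)) , IY.not-nested {q} (Peel.d-< (peels q q<N))

      new-vertex : ∀ p → 1 ℕ.≤ p → suc p ℕ.≤ suc steps →
                   (Σ (Fin m) λ x → x ∈ Xs (suc p) × ¬ (x ∈ Xs p)) ⊎
                   (Σ (Fin k) λ y → y ∈ Ys (suc p) × ¬ (y ∈ Ys p))
      new-vertex (suc q) _ (ℕ.s≤s q<N) =
        Sum.map (IX.new-element {q}) (IY.new-element {q}) (Peel.strict (peels q q<N))

      -- The edges of G_p are those of G_(p-1) together with X_p × Y_p: an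
      -- edge of G_p not in G_(p-1) is newly exposed and hence covered by
      -- the p-th block, which in turn is complete.
      edges-step : ∀ p → 1 ℕ.≤ p → p ℕ.≤ suc steps → ∀ x y →
                   EdgesG E Xs Ys p x y ⇔ (EdgesG E Xs Ys (p ∸ 1) x y ⊎ (x ∈ Xs p × y ∈ Ys p))
      edges-step (suc q) _ (ℕ.s≤s q≤N) x y = mk⇔ to from
        where
        to : EdgesG E Xs Ys (suc q) x y → EdgesG E Xs Ys q x y ⊎ (x ∈ Xs (suc q) × y ∈ Ys (suc q))
        to (e , x∈ , y∈) = split q q≤N (IX.union⁻ {q} {x} q≤N x∈) (IY.union⁻ {q} {y} q≤N y∈)
          where
          split : ∀ q → q ℕ.≤ steps → u (blocks q) ≤X x → v (blocks q) ≤Y y →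
                  EdgesG E Xs Ys q x y ⊎ (x ∈ Xs (suc q) × y ∈ Ys (suc q))
          split zero _ u≤x v≤y = inj₂ ((u≤x , BX.≤-top x) , (v≤y , BY.≤-top y))
          split (suc q) q<N u≤x v≤y =
            Sum.map₁ (λ (u≤x′ , v≤y′) → e , IX.union⁺ {q} {x} (ℕP.<⇒≤ q<N) u≤x′
                                          , IY.union⁺ {q} {y} (ℕP.<⇒≤ q<N) v≤y′)
                     (peel-edge (peels q q<N) e u≤x v≤y)
        from : EdgesG E Xs Ys q x y ⊎ (x ∈ Xs (suc q) × y ∈ Ys (suc q)) → EdgesG E Xs Ys (suc q) x y
        from (inj₁ (e , x∈ , y∈)) = e , union-suc Xs {q} {x} x∈ , union-suc Ys {q} {y} y∈
        from (inj₂ (x∈@(u≤x , x≤c) , y∈@(v≤y , y≤d))) =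
          complete (blocks q) x y u≤x x≤c v≤y y≤d , part⊆union Xs {q} {x} x∈ , part⊆union Ys {q} {y} y∈

-- In a connected bipartite graph with both sides nonempty no vertex is
-- isolated: a walk to a vertex on the other side starts with an edge.
neighbourY : ∀ {m k} {E : BipEdges m k} → Connected E → Fin k → ∀ x → Σ (Fin k) (Edge E x)
neighbourY conn y₀ x with conn (inj₁ x) (inj₂ y₀)
... | _◅_ {j = inj₁ _} () _
... | _◅_ {j = inj₂ y} e  _ = y , e

neighbourX : ∀ {m k} {E : BipEdges m k} → Connected E → Fin m → ∀ y → Σ (Fin m) λ x → Edge E x y
neighbourX conn x₀ y with conn (inj₂ y) (inj₁ x₀)
... | _◅_ {j = inj₁ x} e  _ = x , e
... | _◅_ {j = inj₂ _} () _

-- ℕ's orders under the names used by the statement (qualified above,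
-- where _≤_ and _<_ denote the orders on X and Y)
open import Data.Nat using (_≤_; _<_)

lemma4p5 : (m k : ℕ) → 0 < m → 0 < k → (E : BipEdges m k) →
  Connected E → IsBipPermutationGraph E →
  (_<X_ : Rel (Fin m) 0ℓ) → (_<Y_ : Rel (Fin k) 0ℓ) →
  IsStrongOrdering E _<X_ _<Y_ →
  Σ ℕ λ n → (1 ≤ n) ×
  Σ (ℕ → Pred (Fin m) 0ℓ) λ Xs → Σ (ℕ → Pred (Fin k) 0ℓ) λ Ys →
    (∀ i → 1 ≤ i → i ≤ n → Nonempty (Xs i) × IsInterval _<X_ (Xs i)) ×
    (∀ x → x ∈ UnionUpTo Xs n) ×
    (∀ i → 1 ≤ i → i ≤ n → Nonempty (Ys i) × IsInterval _<Y_ (Ys i)) ×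
    (∀ y → y ∈ UnionUpTo Ys n) ×
    (∀ p → 1 ≤ p → p ≤ n →
       IsEndSegmentOf _<X_ (UnionUpTo Xs p) (Full (Fin m)) ×
       IsInitialSegmentOf _<X_ (Xs p) (UnionUpTo Xs p)) ×
    (∀ p → 1 ≤ p → p ≤ n →
       IsEndSegmentOf _<Y_ (UnionUpTo Ys p) (Full (Fin k)) ×
       IsInitialSegmentOf _<Y_ (Ys p) (UnionUpTo Ys p)) ×
    (∀ p → 1 ≤ p → suc p ≤ n →
       ¬ (Xs p ⊆ Xs (suc p)) × ¬ (Ys p ⊆ Ys (suc p))) ×
    (∀ p → 1 ≤ p → suc p ≤ n →
       (Σ (Fin m) λ x → x ∈ Xs (suc p) × ¬ (x ∈ Xs p)) ⊎
       (Σ (Fin k) λ y → y ∈ Ys (suc p) × ¬ (y ∈ Ys p))) ×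
    (∀ p → 1 ≤ p → p ≤ n → ∀ x y →
       EdgesG E Xs Ys p x y ⇔
         (EdgesG E Xs Ys (p ∸ 1) x y ⊎ (x ∈ Xs p × y ∈ Ys p)))
-- The n = steps + 1 blocks of a descent of the initial block: (1)-(4) hold
-- for the chains of X- and Y-parts, and (5) is edges-step.
lemma4p5 (suc m) (suc k) _ _ E connected _ _ _ strong =
  suc steps , ℕ.s≤s ℕ.z≤n , Xs , Ys ,
  (λ i _ _ → IX.part-nonempty-interval i) , coversX ,
  (λ i _ _ → IY.part-nonempty-interval i) , coversY ,
  IX.segments , IY.segments , not-nested , new-vertex , edges-step
  where
  open StronglyOrderedGraph E strong (neighbourY connected Fin.zero) (neighbourX connected Fin.zero)
  open Peeling Fin.zero Fin.zero
  open Decomposition (descent initial)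
  open Descent (descent initial) using (steps)
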